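{- Let $P=(X,\leq_P)$ and $Q$ be finite posets, each with at least two points and without isolated points, and let $Q$ have height one. Let $f : E(P) \rightarrow Q$ be a strict surjective order-preserving map, where $E(P)$ carries the order induced from $P$. Then there exists an order-preserving map $g : P \rightarrow Q$ with $g|_{E(P)} = f$ if and only if the following condition holds: no 4-element set $F \subseteq E(P)$ which contains points from two different sets $f^{ -1}(a), f^{ -1}(b)$ with $a,b \in L(Q)$ and points from two different sets $f^{ -1}(v), f^{ -1}(w)$ with $v,w \in U(Q)$ is an improper 4-crown in $P$.
   Context: For a poset $P=(X,\leq_P)$: $L(P)$ and $U(P)$ are the sets of minimal and maximal points, $E(P):=L(P)\cup U(P)$. For $x,y\in X$, ${\downarrow}_P y := \{x : x\leq_P y\}$, ${\uparrow}_P y := \{x : y \leq_P x\}$, $[x,y]_P := {\uparrow}_P x \cap {\downarrow}_P y$. A 4-crown in $P$ is a 4-element set $\{a,b,v,w\}\subseteq X$ with $a<_P v$, $a<_P w$, $b<_P v$, $b<_P w$, $a \parallel b$, $v\parallel w$. Its inner is $\mathcal{J}_P := [a,v]_P\cap[b,w]_P$ (this equals $[a,w]_P\cap[b,v]_P$); the 4-crown is improper in $P$ if its inner is nonempty and proper otherwise. An order-preserving map $f:E(P)\to Q$ is called strict if $f[L(P)]\subseteq L(Q)$ and $f[U(P)]\subseteq U(Q)$. -}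

module Defs where

open import Data.Nat using (ℕ)
open import Data.Fin using (Fin)
open import Data.Product using (Σ; ∃; _×_; _,_)
open import Data.Sum using (_⊎_)
open import Relation.Nullary using (¬_)
open import Relation.Binary using (IsPartialOrder; Decidable)
open import Relation.Binary.PropositionalEquality using (_≡_; _≢_)

record FinPoset : Set₁ where
  field
    size  : ℕ
    _≤_   : Fin size → Fin size → Set
    isPartialOrder : IsPartialOrder _≡_ _≤_
    _≤?_  : Decidable _≤_

  Pt : Set
  Pt = Fin size

  _<_ : Pt → Pt → Set
  x < y = (x ≤ y) × (x ≢ y)

  _∥_ : Pt → Pt → Set
  x ∥ y = ¬ (x ≤ y) × ¬ (y ≤ x)

  IsMin : Pt → Set
  IsMin x = ∀ y → y ≤ x → y ≡ x

  IsMax : Pt → Set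
  IsMax x = ∀ y → x ≤ y → y ≡ x

  IsE : Pt → Set
  IsE x = IsMin x ⊎ IsMax x

  Isolated : Pt → Set
  Isolated x = ∀ y → y ≢ x → (x ∥ y)

  NoIsolated : Set
  NoIsolated = ∀ x → ¬ Isolated x

  HeightOne : Set
  HeightOne = (Σ Pt λ x → Σ Pt λ y → x < y)
            × (∀ x y z → ¬ ((x < y) × (y < z)))

open FinPoset public using (size; NoIsolated; HeightOne)

module _ (P Q : FinPoset) where
  private
    module P = FinPoset P
    module Q = FinPoset Q

  -- A map E(P) → Q is represented by a total function on points of P,
  -- of which only the values on E(P) are ever used.
  OrderPreservingOnE : (Fin (size P) → Fin (size Q)) → Set
  OrderPreservingOnE f = ∀ x y → P.IsE x → P.IsE y → x P.≤ y → f x Q.≤ f y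

  StrictOnE : (Fin (size P) → Fin (size Q)) → Set
  StrictOnE f = (∀ x → P.IsMin x → Q.IsMin (f x)) × (∀ x → P.IsMax x → Q.IsMax (f x))

  SurjectiveOnE : (Fin (size P) → Fin (size Q)) → Set
  SurjectiveOnE f = ∀ q → Σ P.Pt λ x → P.IsE x × (f x ≡ q)

  OrderPreserving : (Fin (size P) → Fin (size Q)) → Set
  OrderPreserving g = ∀ x y → x P.≤ y → g x Q.≤ g y

  Extends : (g f : Fin (size P) → Fin (size Q)) → Set
  Extends g f = ∀ x → P.IsE x → g x ≡ f x

  IsFourCrown : (a b v w : P.Pt) → Set
  IsFourCrown a b v w = (a P.< v) × (a P.< w) × (b P.< v) × (b P.< w) × (a P.∥ b) × (v P.∥ w)

  Improper : (a b v w : P.Pt) → Set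
  Improper a b v w = Σ P.Pt λ z → (a P.≤ z × z P.≤ v) × (b P.≤ z × z P.≤ w)

  _∈₄_ : P.Pt → (P.Pt × P.Pt × P.Pt × P.Pt) → Set
  z ∈₄ (a , b , v , w) = (z ≡ a) ⊎ (z ≡ b) ⊎ (z ≡ v) ⊎ (z ≡ w)

  MeetsTwoFibres : (Fin (size P) → Fin (size Q)) → (P.Pt × P.Pt × P.Pt × P.Pt) → Set
  MeetsTwoFibres f F =
      (Σ P.Pt λ p → Σ P.Pt λ p' → p ∈₄ F × p' ∈₄ F
         × Q.IsMin (f p) × Q.IsMin (f p') × f p ≢ f p')
    × (Σ P.Pt λ p → Σ P.Pt λ p' → p ∈₄ F × p' ∈₄ F
         × Q.IsMax (f p) × Q.IsMax (f p') × f p ≢ f p')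

  -- no 4-element F ⊆ E(P) meeting two L(Q)-fibres and two U(Q)-fibres
  -- is an improper 4-crown in P  (a 4-crown has 4 distinct elements automatically)
  CrownCondition : (Fin (size P) → Fin (size Q)) → Set
  CrownCondition f = ∀ a b v w →
    P.IsE a → P.IsE b → P.IsE v → P.IsE w →
    MeetsTwoFibres f (a , b , v , w) →
    IsFourCrown a b v w → ¬ Improper a b v w

{-# OPTIONS --safe #-}
-- Call a point z obstructed when the minimal points below z meet two fibres of f
-- and so do the maximal points above z; such a z is exactly an inner point of a
-- crown forbidden by the crown condition. An order-preserving extension g cannot
-- have an obstructed point: g z lies above f a, f b and below f v, f w, and in a
-- height-one Q this forces f a = f b or f v = f w. Conversely, without obstructed
-- points f extends: send z to the common value of f on the maximal points above z
-- when z is maximal or the minimal points below z meet two fibres, and to the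
-- common value of f on the minimal points below z otherwise.
module Submission where

open import Defs
open import Data.Nat using (_≤_)
open import Data.Fin using (Fin; _≟_)
open import Data.Fin.Properties using (any?; all?)
open import Data.Fin.Induction using (po-wellFounded)
open import Data.Product using (Σ; _×_; _,_; proj₁; proj₂; curry)
open import Data.Sum using (_⊎_; inj₁; inj₂; [_,_]′; reduce)
open import Data.Empty using (⊥; ⊥-elim)
open import Function using (_∘_; flip)
open import Function.Bundles using (_⇔_; mk⇔)
open import Induction.WellFounded using (Acc; acc)
open import Relation.Nullary using (¬_; Dec; yes; no)
open import Relation.Nullary.Decidable using (_×-dec_; _⊎-dec_; _→-dec_; ¬?; decidable-stable; toSum)
open import Relation.Binary using (IsPartialOrder)
import Relation.Binary.Construct.Flip.EqAndOrd as Flip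
open import Relation.Binary.PropositionalEquality using (_≡_; _≢_; refl; sym; trans; cong; subst; subst₂)

distinct-in-pair⇒≢ : ∀ {A : Set} {x y s t : A} → x ≡ s ⊎ x ≡ t → y ≡ s ⊎ y ≡ t → x ≢ y → s ≢ t
distinct-in-pair⇒≢ x∈ y∈ x≢y refl = x≢y (trans (reduce x∈) (sym (reduce y∈)))

dual : FinPoset → FinPoset
dual P = record
  { size           = size P
  ; _≤_            = flip (FinPoset._≤_ P)
  ; isPartialOrder = Flip.isPartialOrder (FinPoset.isPartialOrder P)
  ; _≤?_           = flip (FinPoset._≤?_ P)
  }

module _ (P : FinPoset) where
  open FinPoset P using (Pt; _≤?_; _<_; _∥_; IsMin; IsMax; IsE; isPartialOrder) renaming (_≤_ to _⊑_)
  open IsPartialOrder isPartialOrder using () renaming (refl to ⊑-refl; trans to ⊑-trans)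

  MinBelow : Pt → Pt → Set
  MinBelow z a = IsMin a × a ⊑ z

  MaxAbove : Pt → Pt → Set
  MaxAbove z v = IsMax v × z ⊑ v

  isMin? : ∀ x → Dec (IsMin x)
  isMin? x = all? λ y → (y ≤? x) →-dec (y ≟ x)

  minimal-below : ∀ z → Σ Pt (MinBelow z)
  minimal-below z = go z (po-wellFounded isPartialOrder z)
    where
    go : ∀ z → Acc _<_ z → Σ Pt (MinBelow z)
    go z (acc below) with any? (λ y → (y ≤? z) ×-dec ¬? (y ≟ z))
    ... | yes (y , y<z) = let a , ma , a⊑y = go y (below y<z) in a , ma , ⊑-trans a⊑y (proj₁ y<z)
    ... | no ∄y<z = z , (λ y y⊑z → decidable-stable (y ≟ z) λ y≢z → ∄y<z (y , y⊑z , y≢z)) , ⊑-refl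

  E-below⇒min : ∀ {x y} → IsE x → x < y → IsMin x
  E-below⇒min (inj₁ mx) _         = mx
  E-below⇒min (inj₂ Mx) (x⊑y , x≢y) = ⊥-elim (x≢y (sym (Mx _ x⊑y)))

  E-above⇒max : ∀ {x y} → IsE y → x < y → IsMax y
  E-above⇒max (inj₁ my) (x⊑y , x≢y) = ⊥-elim (x≢y (my _ x⊑y))
  E-above⇒max (inj₂ My) _         = My

  distinct-min⇒∥ : ∀ {a b} → IsMin a → IsMin b → a ≢ b → a ∥ b
  distinct-min⇒∥ ma mb a≢b = (λ a⊑b → a≢b (mb _ a⊑b)) , (λ b⊑a → a≢b (sym (ma _ b⊑a)))

  distinct-max⇒∥ : ∀ {v w} → IsMax v → IsMax w → v ≢ w → v ∥ w
  distinct-max⇒∥ Mv Mw v≢w = (λ v⊑w → v≢w (sym (Mv _ v⊑w))) , (λ w⊑v → v≢w (Mw _ w⊑v))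

  NoIsolated⇒¬min×max : NoIsolated P → ∀ {p} → IsMin p → IsMax p → ⊥
  NoIsolated⇒¬min×max noIsolated {p} mp Mp =
    noIsolated p λ y y≢p → (λ p⊑y → y≢p (Mp y p⊑y)) , (λ y⊑p → y≢p (mp y y⊑p))

  HeightOne⇒bounds-coincide : HeightOne P → ∀ {p p' c q q'} → IsMin p → IsMax q →
    p ⊑ c → p' ⊑ c → c ⊑ q → c ⊑ q' → p' ≡ p ⊎ q' ≡ q
  HeightOne⇒bounds-coincide (_ , no-3-chain) {p} {p'} {c} {q} {q'} mp Mq p⊑c p'⊑c c⊑q c⊑q'
    with c ≟ p | c ≟ q
  ... | yes refl | _        = inj₁ (mp p' p'⊑c)
  ... | no _     | yes refl = inj₂ (Mq q' c⊑q')
  ... | no c≢p   | no c≢q   = ⊥-elim (no-3-chain p c q ((p⊑c , c≢p ∘ sym) , (c⊑q , c≢q)))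

module _ (P : FinPoset) where
  open FinPoset P using (Pt; IsMax)

  isMax? : ∀ x → Dec (IsMax x)
  isMax? = isMin? (dual P)

  maximal-above : ∀ z → Σ Pt (MaxAbove P z)
  maximal-above = minimal-below (dual P)

module Crowns (P Q : FinPoset) (f : Fin (size P) → Fin (size Q)) where
  private
    module P = FinPoset P
    module Q = FinPoset Q
  open IsPartialOrder P.isPartialOrder using () renaming (refl to ⊑-refl; trans to ⊑-trans)
  open IsPartialOrder Q.isPartialOrder using () renaming (refl to ≤-refl)

  TwoValued : (P.Pt → Set) → Set
  TwoValued S = Σ P.Pt λ a → Σ P.Pt λ b → S a × S b × f a ≢ f b

  twoValued? : ∀ {S} → (∀ x → Dec (S x)) → Dec (TwoValued S)
  twoValued? S? = any? λ a → any? λ b → S? a ×-dec S? b ×-dec ¬? (f a ≟ f b)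

  ¬twoValued⇒constant : ∀ {S a b} → ¬ TwoValued S → S a → S b → f a ≡ f b
  ¬twoValued⇒constant ¬two Sa Sb = decidable-stable (_ ≟ _) λ fa≢fb → ¬two (_ , _ , Sa , Sb , fa≢fb)

  min⇒¬twoValued-below : ∀ {z} → P.IsMin z → ¬ TwoValued (MinBelow P z)
  min⇒¬twoValued-below mz (a , b , (_ , a⊑z) , (_ , b⊑z) , fa≢fb) =
    fa≢fb (cong f (trans (mz a a⊑z) (sym (mz b b⊑z))))

  max⇒¬twoValued-above : ∀ {z} → P.IsMax z → ¬ TwoValued (MaxAbove P z)
  max⇒¬twoValued-above Mz (v , w , (_ , z⊑v) , (_ , z⊑w) , fv≢fw) =
    fv≢fw (cong f (trans (Mz v z⊑v) (sym (Mz w z⊑w))))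

  Obstructed : P.Pt → Set
  Obstructed z = TwoValued (MinBelow P z) × TwoValued (MaxAbove P z)

  Unobstructed : Set
  Unobstructed = ∀ z → ¬ Obstructed z

  Extension : Set
  Extension = Σ (P.Pt → Q.Pt) λ g → OrderPreserving P Q g × Extends P Q g f

  crown-condition⇒unobstructed : NoIsolated P → StrictOnE P Q f → CrownCondition P Q f → Unobstructed
  crown-condition⇒unobstructed noIsolated (strict-min , strict-max) crown-free z
    ((a , b , (ma , a⊑z) , (mb , b⊑z) , fa≢fb) , (v , w , (Mv , z⊑v) , (Mw , z⊑w) , fv≢fw)) =
    crown-free a b v w (inj₁ ma) (inj₁ mb) (inj₂ Mv) (inj₂ Mw) meets crown (z , (a⊑z , z⊑v) , (b⊑z , z⊑w))
    where
    meets : MeetsTwoFibres P Q f (a , b , v , w)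
    meets = (a , b , inj₁ refl , inj₂ (inj₁ refl) , strict-min a ma , strict-min b mb , fa≢fb)
          , (v , w , inj₂ (inj₂ (inj₁ refl)) , inj₂ (inj₂ (inj₂ refl)) , strict-max v Mv , strict-max w Mw , fv≢fw)

    min<max : ∀ {x y} → P.IsMin x → P.IsMax y → x P.≤ y → x P.< y
    min<max mx My x⊑y = x⊑y , λ { refl → NoIsolated⇒¬min×max P noIsolated mx My }

    crown : IsFourCrown P Q a b v w
    crown = min<max ma Mv (⊑-trans a⊑z z⊑v) , min<max ma Mw (⊑-trans a⊑z z⊑w)
          , min<max mb Mv (⊑-trans b⊑z z⊑v) , min<max mb Mw (⊑-trans b⊑z z⊑w)
          , distinct-min⇒∥ P ma mb (fa≢fb ∘ cong f) , distinct-max⇒∥ P Mv Mw (fv≢fw ∘ cong f)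

  unobstructed⇒crown-condition : NoIsolated Q → StrictOnE P Q f → Unobstructed → CrownCondition P Q f
  unobstructed⇒crown-condition noIsolated (strict-min , strict-max) unobstructed a b v w Ea Eb Ev Ew
    ((p , p' , p∈ , p'∈ , mp , mp' , fp≢fp') , (q , q' , q∈ , q'∈ , Mq , Mq' , fq≢fq'))
    (a<v , a<w , b<v , _ , _ , _) (z , (a⊑z , z⊑v) , (b⊑z , z⊑w)) =
    unobstructed z
      ( (a , b , (ma , a⊑z) , (mb , b⊑z) , distinct-in-pair⇒≢ (lower p∈ mp) (lower p'∈ mp') fp≢fp')
      , (v , w , (Mv , z⊑v) , (Mw , z⊑w) , distinct-in-pair⇒≢ (upper q∈ Mq) (upper q'∈ Mq') fq≢fq'))
    where
    ma : P.IsMin a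
    ma = E-below⇒min P Ea a<v
    mb : P.IsMin b
    mb = E-below⇒min P Eb b<v
    Mv : P.IsMax v
    Mv = E-above⇒max P Ev a<v
    Mw : P.IsMax w
    Mw = E-above⇒max P Ew a<w

    ¬min×max : ∀ {q} → Q.IsMin q → Q.IsMax q → ⊥
    ¬min×max = NoIsolated⇒¬min×max Q noIsolated

    lower : ∀ {x} → _∈₄_ P Q x (a , b , v , w) → Q.IsMin (f x) → f x ≡ f a ⊎ f x ≡ f b
    lower (inj₁ refl)               _  = inj₁ refl
    lower (inj₂ (inj₁ refl))        _  = inj₂ refl
    lower (inj₂ (inj₂ (inj₁ refl))) mx = ⊥-elim (¬min×max mx (strict-max v Mv))
    lower (inj₂ (inj₂ (inj₂ refl))) mx = ⊥-elim (¬min×max mx (strict-max w Mw))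

    upper : ∀ {x} → _∈₄_ P Q x (a , b , v , w) → Q.IsMax (f x) → f x ≡ f v ⊎ f x ≡ f w
    upper (inj₁ refl)               Mx = ⊥-elim (¬min×max (strict-min a ma) Mx)
    upper (inj₂ (inj₁ refl))        Mx = ⊥-elim (¬min×max (strict-min b mb) Mx)
    upper (inj₂ (inj₂ (inj₁ refl))) _  = inj₁ refl
    upper (inj₂ (inj₂ (inj₂ refl))) _  = inj₂ refl

  extension⇒unobstructed : HeightOne Q → StrictOnE P Q f → Extension → Unobstructed
  extension⇒unobstructed heightOne (strict-min , strict-max) (g , g-mono , g-extends) z
    ((a , b , (ma , a⊑z) , (mb , b⊑z) , fa≢fb) , (v , w , (Mv , z⊑v) , (Mw , z⊑w) , fv≢fw)) =
    [ fa≢fb ∘ sym , fv≢fw ∘ sym ]′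
      (HeightOne⇒bounds-coincide Q heightOne (strict-min a ma) (strict-max v Mv)
        (below (inj₁ ma) a⊑z) (below (inj₁ mb) b⊑z) (above (inj₂ Mv) z⊑v) (above (inj₂ Mw) z⊑w))
    where
    below : ∀ {x} → P.IsE x → x P.≤ z → f x Q.≤ g z
    below {x} Ex x⊑z = subst (Q._≤ g z) (g-extends x Ex) (g-mono x z x⊑z)

    above : ∀ {x} → P.IsE x → z P.≤ x → g z Q.≤ f x
    above {x} Ex z⊑x = subst (g z Q.≤_) (g-extends x Ex) (g-mono z x z⊑x)

  ReadAbove : P.Pt → Set
  ReadAbove z = P.IsMax z ⊎ TwoValued (MinBelow P z)

  readAbove? : ∀ z → Dec (ReadAbove z)
  readAbove? z = isMax? P z ⊎-dec twoValued? λ a → isMin? P a ×-dec (a P.≤? z)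

  readAbove-mono : ∀ {x y} → x P.≤ y → ReadAbove x → ReadAbove y
  readAbove-mono {y = y} x⊑y (inj₁ Mx) = inj₁ (subst P.IsMax (sym (Mx y x⊑y)) Mx)
  readAbove-mono x⊑y (inj₂ (a , b , (ma , a⊑x) , (mb , b⊑x) , fa≢fb)) =
    inj₂ (a , b , (ma , ⊑-trans a⊑x x⊑y) , (mb , ⊑-trans b⊑x x⊑y) , fa≢fb)

  extend : P.Pt → Q.Pt
  extend z with readAbove? z
  ... | yes _ = f (proj₁ (maximal-above P z))
  ... | no _  = f (proj₁ (minimal-below P z))

  extend-below : ∀ {z a} → ¬ ReadAbove z → MinBelow P z a → f a ≡ extend z
  extend-below {z} ¬above a∈ with readAbove? z
  ... | yes above = ⊥-elim (¬above above)
  ... | no _      = ¬twoValued⇒constant (¬above ∘ inj₂) a∈ (proj₂ (minimal-below P z))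

  extend-above : Unobstructed → ∀ {z v} → ReadAbove z → MaxAbove P z v → f v ≡ extend z
  extend-above unobstructed {z} above v∈ with readAbove? z
  ... | no ¬above = ⊥-elim (¬above above)
  ... | yes _     = ¬twoValued⇒constant single-valued v∈ (proj₂ (maximal-above P z))
    where
    single-valued : ¬ TwoValued (MaxAbove P z)
    single-valued = [ max⇒¬twoValued-above , curry (unobstructed z) ]′ above

  -- The case splits below go through toSum so that with does not abstract the
  -- occurrences of the decision inside extend, which extend-below/above rely on.
  extend-extends : Unobstructed → Extends P Q extend f
  extend-extends unobstructed z Ez with toSum (isMax? P z) | Ez
  ... | inj₁ Mz  | _        = sym (extend-above unobstructed (inj₁ Mz) (Mz , ⊑-refl))
  ... | inj₂ ¬Mz | inj₂ Mz  = ⊥-elim (¬Mz Mz)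
  ... | inj₂ ¬Mz | inj₁ mz  = sym (extend-below [ ¬Mz , min⇒¬twoValued-below mz ]′ (mz , ⊑-refl))

  extend-mono : OrderPreservingOnE P Q f → Unobstructed → OrderPreserving P Q extend
  extend-mono f-mono unobstructed x y x⊑y
    with toSum (readAbove? x) | toSum (readAbove? y) | minimal-below P x | maximal-above P y
  ... | inj₁ above-x | inj₂ ¬above-y | _ | _ = ⊥-elim (¬above-y (readAbove-mono x⊑y above-x))
  ... | inj₂ ¬above-x | inj₂ ¬above-y | a , ma , a⊑x | _ =
    subst₂ Q._≤_ (extend-below ¬above-x (ma , a⊑x)) (extend-below ¬above-y (ma , ⊑-trans a⊑x x⊑y)) ≤-refl
  ... | inj₂ ¬above-x | inj₁ above-y | a , ma , a⊑x | v , Mv , y⊑v =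
    subst₂ Q._≤_ (extend-below ¬above-x (ma , a⊑x)) (extend-above unobstructed above-y (Mv , y⊑v))
      (f-mono a v (inj₁ ma) (inj₂ Mv) (⊑-trans a⊑x (⊑-trans x⊑y y⊑v)))
  ... | inj₁ above-x | inj₁ above-y | _ | v , Mv , y⊑v =
    subst₂ Q._≤_ (extend-above unobstructed above-x (Mv , ⊑-trans x⊑y y⊑v))
      (extend-above unobstructed above-y (Mv , y⊑v)) ≤-refl

  unobstructed⇒extension : OrderPreservingOnE P Q f → Unobstructed → Extension
  unobstructed⇒extension f-mono unobstructed =
    extend , extend-mono f-mono unobstructed , extend-extends unobstructed

lemma2 : (P Q : FinPoset) →
    2 ≤ size P → 2 ≤ size Q →
    NoIsolated P → NoIsolated Q → HeightOne Q →
    (f : Fin (size P) → Fin (size Q)) →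
    OrderPreservingOnE P Q f → StrictOnE P Q f → SurjectiveOnE P Q f →
    (Σ (Fin (size P) → Fin (size Q)) λ g → OrderPreserving P Q g × Extends P Q g f)
      ⇔ CrownCondition P Q f
lemma2 P Q _ _ noIsolatedP noIsolatedQ heightOne f f-mono strict _ =
  mk⇔ (unobstructed⇒crown-condition noIsolatedQ strict ∘ extension⇒unobstructed heightOne strict)
      (unobstructed⇒extension f-mono ∘ crown-condition⇒unobstructed noIsolatedP strict)
  where open Crowns P Q f
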